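{- Let $H$ be a graph and let $G$ be a $K_1\vee H$-saturated graph of order $n$. If the maximum degree of $G$ is $\Delta(G)=n-1$, then $|E(G)|\geq n-1+sat(n-1,H)$, and equality holds if and only if $G\cong K_1\vee F$, where $F$ is an $H$-saturated graph of order $n-1$ with exactly $sat(n-1,H)$ edges.
   Context: All graphs are finite and simple. $G_1\vee G_2$ denotes the join (disjoint union plus all edges between the two parts). A graph $G$ is $H$-saturated if it contains no copy of $H$ but adding any missing edge creates a copy of $H$; $sat(n,H)$ is the minimum number of edges of an $H$-saturated graph on $n$ vertices. -}

module Defs where

open import Data.Nat using (ℕ; zero; suc; _+_; _≤_; _⊔_)
open import Data.Bool using (Bool; true; false; _∧_; _∨_; if_then_else_)
open import Data.Fin using (Fin; zero; suc; toℕ)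
open import Data.Fin.Properties using (_≟_)
open import Data.Nat.Properties using (_<?_)
open import Data.List using (List; map; foldr; allFin)
open import Data.Nat.ListAction using (sum)
open import Data.Product using (Σ; ∃; _×_)
open import Relation.Binary.PropositionalEquality using (_≡_; _≢_)
open import Relation.Nullary using (¬_)
open import Relation.Nullary.Decidable using (⌊_⌋)
open import Function.Definitions using (Injective)
open import Function.Bundles using (_↔_; Inverse)

Graph : ℕ → Set
Graph n = Fin n → Fin n → Bool

IsSimple : ∀ {n} → Graph n → Set
IsSimple G = (∀ i j → G i j ≡ G j i) × (∀ i → G i i ≡ false)

edges : ∀ {n} → Graph n → ℕ
edges {n} G = sum (map (λ i → sum (map (λ j →
  if ⌊ toℕ i <? toℕ j ⌋ ∧ G i j then 1 else 0) (allFin n))) (allFin n))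

degree : ∀ {n} → Graph n → Fin n → ℕ
degree {n} G v = sum (map (λ j → if G v j then 1 else 0) (allFin n))

maxDegree : ∀ {n} → Graph n → ℕ
maxDegree {n} G = foldr _⊔_ 0 (map (degree G) (allFin n))

Contains : ∀ {h n} → Graph h → Graph n → Set
Contains {h} {n} H G = Σ (Fin h → Fin n) λ f →
  Injective _≡_ _≡_ f × (∀ i j → H i j ≡ true → G (f i) (f j) ≡ true)

addEdge : ∀ {n} → Graph n → Fin n → Fin n → Graph n
addEdge G u v i j =
  G i j ∨ ((⌊ i ≟ u ⌋ ∧ ⌊ j ≟ v ⌋) ∨ (⌊ i ≟ v ⌋ ∧ ⌊ j ≟ u ⌋))

Saturated : ∀ {h n} → Graph h → Graph n → Set
Saturated H G = IsSimple G × ¬ Contains H G ×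
  (∀ u v → u ≢ v → G u v ≡ false → Contains H (addEdge G u v))

IsSatNumber : ∀ {h} → ℕ → Graph h → ℕ → Set
IsSatNumber n H s =
  (Σ (Graph n) λ F → Saturated H F × edges F ≡ s) ×
  (∀ (F : Graph n) → Saturated H F → s ≤ edges F)

-- K₁ ∨ F, the new vertex being zero.
join1 : ∀ {m} → Graph m → Graph (suc m)
join1 F zero zero = false
join1 F zero (suc j) = true
join1 F (suc i) zero = true
join1 F (suc i) (suc j) = F i j

_≅_ : ∀ {n} → Graph n → Graph n → Set
_≅_ {n} G G' = Σ (Fin n ↔ Fin n) λ f →
  ∀ i j → G i j ≡ G' (Inverse.to f i) (Inverse.to f j)

-- A vertex v of degree n − 1 is adjacent to every other vertex, so G ≅ K₁ ∨ F
-- with F = G − v, and |E(G)| = (n − 1) + |E(F)|.  F is H-saturated: a copy of H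
-- in F together with v would be a copy of K₁ ∨ H in G, and for a non-edge xy of
-- F, the copy of K₁ ∨ H in G + xy can be made to avoid v by exchanging its apex
-- with the vertex of H lying on v, which leaves a copy of H in F + xy.  Hence
-- |E(F)| ≥ sat(n − 1, H), with equality exactly when |E(G)| = n − 1 + sat(n − 1, H).
module Submission where

open import Defs
open import Data.Nat.Properties hiding (_≟_; 0≢1+n)
open import Algebra.Properties.CommutativeMonoid.Sum +-0-commutativeMonoid
  using (sum; sum-syntax; sum-cong-≗; sum-remove; sum-permute; ∑-distrib-+; ∑-comm)
open import Data.Bool using (Bool; true; false; _∧_; if_then_else_)
open import Data.Fin using (Fin; zero; suc; toℕ; punchIn; punchOut)
open import Data.Fin.Permutation using (Permutation′; _⟨$⟩ʳ_; insert; insert-punchIn; id)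
open import Data.Fin.Properties
  using (_≟_; 0≢1+n; toℕ-injective; punchIn-injective; punchInᵢ≢i; punchOut-injective; punchIn-punchOut)
  renaming (suc-injective to Fin-suc-injective)
open import Data.List using (map; allFin; tabulate)
open import Data.List.Membership.Propositional.Properties using (foldr-selective; ∈-map⁻)
open import Data.List.Properties using (map-tabulate)
open import Data.Nat using (ℕ; zero; suc; _+_; _*_; _≤_; _<_; z≤n; s≤s; s<s⁻¹)
import Data.Nat.ListAction as List
open import Data.Product using (Σ; ∃; _×_; _,_; proj₁; proj₂)
open import Data.Sum using (inj₁; inj₂)
open import Function using (_∘_; _⇔_; mk⇔)
open import Function.Definitions using (Injective)
open import Relation.Binary.Definitions using (tri<; tri≈; tri>)
open import Relation.Binary.PropositionalEquality
open import Relation.Nullary using (yes; no; contradiction)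
open import Relation.Nullary.Decidable using (⌊_⌋; dec-yes; dec-no)

private
  variable
    h m n : ℕ

listSum-allFin : (f : Fin n → ℕ) → List.sum (map f (allFin n)) ≡ ∑[ i < n ] f i
listSum-allFin f = trans (cong List.sum (map-tabulate (λ i → i) f)) (listSum-tabulate f)
  where
  listSum-tabulate : ∀ {n} (f : Fin n → ℕ) → List.sum (tabulate f) ≡ ∑[ i < n ] f i
  listSum-tabulate {zero}  f = refl
  listSum-tabulate {suc n} f = cong (f zero +_) (listSum-tabulate (f ∘ suc))

∑-const-1 : ∀ n → ∑[ i < n ] 1 ≡ n
∑-const-1 zero    = refl
∑-const-1 (suc n) = cong suc (∑-const-1 n)

∑-≤1⇒≤ : (f : Fin n → ℕ) → (∀ i → f i ≤ 1) → ∑[ i < n ] f i ≤ n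
∑-≤1⇒≤ {zero}  f f≤1 = ≤-refl
∑-≤1⇒≤ {suc n} f f≤1 = +-mono-≤ (f≤1 zero) (∑-≤1⇒≤ (f ∘ suc) (f≤1 ∘ suc))

∑-≤1-with-zero⇒< : (f : Fin n → ℕ) → (∀ i → f i ≤ 1) → ∀ k → f k ≡ 0 → ∑[ i < n ] f i < n
∑-≤1-with-zero⇒< {suc n} f f≤1 k fk≡0 = begin-strict
  ∑[ i < suc n ] f i                         ≡⟨ sum-remove {i = k} f ⟩
  f k + ∑[ i < n ] f (punchIn k i)           ≡⟨ cong (_+ ∑[ i < n ] f (punchIn k i)) fk≡0 ⟩
  ∑[ i < n ] f (punchIn k i)                 ≤⟨ ∑-≤1⇒≤ (f ∘ punchIn k) (f≤1 ∘ punchIn k) ⟩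
  n                                          <⟨ n<1+n n ⟩
  suc n                                      ∎
  where open ≤-Reasoning

indicator : Bool → ℕ
indicator b = if b then 1 else 0

indicator≤1 : ∀ b → indicator b ≤ 1
indicator≤1 true  = ≤-refl
indicator≤1 false = z≤n

degree-∑ : (G : Graph n) (v : Fin n) → degree G v ≡ ∑[ j < n ] indicator (G v j)
degree-∑ G v = listSum-allFin (indicator ∘ G v)

maxDegree-attained : (G : Graph (suc m)) → ∃ λ v → maxDegree G ≤ degree G v
maxDegree-attained {m} G with foldr-selective ⊔-sel 0 (map (degree G) (allFin (suc m)))
... | inj₁ Δ≡0 = zero , ≤-trans (≤-reflexive Δ≡0) z≤n
... | inj₂ Δ∈ with ∈-map⁻ (degree G) Δ∈
...   | v , _ , Δ≡deg = v , ≤-reflexive Δ≡deg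

degreeSum : Graph n → ℕ
degreeSum {n} G = ∑[ i < n ] ∑[ j < n ] indicator (G i j)

upper : Graph n → Fin n → Fin n → ℕ
upper G i j = if ⌊ toℕ i <? toℕ j ⌋ ∧ G i j then 1 else 0

edges-∑ : (G : Graph n) → edges G ≡ ∑[ i < n ] ∑[ j < n ] upper G i j
edges-∑ {n} G = trans (listSum-allFin (λ i → List.sum (map (upper G i) (allFin n))))
                      (sum-cong-≗ (λ i → listSum-allFin (upper G i)))

indicator-split : (G : Graph n) → IsSimple G → ∀ i j → indicator (G i j) ≡ upper G i j + upper G j i
indicator-split G (symmetric , loopless) i j with <-cmp (toℕ i) (toℕ j)
... | tri< i<j _ j≮i
  rewrite proj₂ (dec-yes (toℕ i <? toℕ j) i<j) | dec-no (toℕ j <? toℕ i) j≮i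
  = sym (+-identityʳ _)
... | tri> i≮j _ j<i
  rewrite dec-no (toℕ i <? toℕ j) i≮j | proj₂ (dec-yes (toℕ j <? toℕ i) j<i) | symmetric i j
  = refl
... | tri≈ i≮j i≡j _
  rewrite toℕ-injective i≡j | dec-no (toℕ j <? toℕ j) i≮j | loopless j
  = refl

handshake : (G : Graph n) → IsSimple G → degreeSum G ≡ 2 * edges G
handshake {n} G simple = begin
  degreeSum G
    ≡⟨ sum-cong-≗ (λ i → sum-cong-≗ (indicator-split G simple i)) ⟩
  ∑[ i < n ] ∑[ j < n ] (upper G i j + upper G j i)
    ≡⟨ sum-cong-≗ (λ i → ∑-distrib-+ (upper G i) (λ j → upper G j i)) ⟩
  ∑[ i < n ] (∑[ j < n ] upper G i j + ∑[ j < n ] upper G j i)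
    ≡⟨ ∑-distrib-+ (λ i → ∑[ j < n ] upper G i j) (λ i → ∑[ j < n ] upper G j i) ⟩
  U + ∑[ i < n ] ∑[ j < n ] upper G j i
    ≡⟨ cong (U +_) (∑-comm (λ i j → upper G j i)) ⟩
  U + U
    ≡⟨ cong (U +_) (sym (+-identityʳ U)) ⟩
  2 * U
    ≡⟨ cong (2 *_) (edges-∑ G) ⟨
  2 * edges G ∎
  where
  open ≡-Reasoning
  U : ℕ
  U = ∑[ i < n ] ∑[ j < n ] upper G i j

degreeSum-≅ : {G G′ : Graph n} → G ≅ G′ → degreeSum G ≡ degreeSum G′
degreeSum-≅ {n} {G} {G′} (π , G≡G′∘π) = begin
  degreeSum G
    ≡⟨ sum-cong-≗ (λ i → sum-cong-≗ (λ j → cong indicator (G≡G′∘π i j))) ⟩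
  ∑[ i < n ] ∑[ j < n ] indicator (G′ (π ⟨$⟩ʳ i) (π ⟨$⟩ʳ j))
    ≡⟨ sum-cong-≗ (λ i → sum-permute (λ j → indicator (G′ (π ⟨$⟩ʳ i) j)) π) ⟨
  ∑[ i < n ] ∑[ j < n ] indicator (G′ (π ⟨$⟩ʳ i) j)
    ≡⟨ sum-permute (λ i → ∑[ j < n ] indicator (G′ i j)) π ⟨
  degreeSum G′ ∎
  where open ≡-Reasoning

-- `edges` counts pairs i < j, an order no relabelling respects; the degree sum
-- is relabelling-invariant, and the handshake lemma transfers this to `edges`.
edges-≅ : {G G′ : Graph n} → IsSimple G → IsSimple G′ → G ≅ G′ → edges G ≡ edges G′
edges-≅ {G = G} {G′} simple simple′ G≅G′ = *-cancelˡ-≡ _ _ 2 (begin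
  2 * edges G    ≡⟨ handshake G simple ⟨
  degreeSum G    ≡⟨ degreeSum-≅ G≅G′ ⟩
  degreeSum G′   ≡⟨ handshake G′ simple′ ⟩
  2 * edges G′   ∎)
  where open ≡-Reasoning

join1-simple : {F : Graph m} → IsSimple F → IsSimple (join1 F)
join1-simple {F = F} (symmetric , loopless) = symmetric′ , loopless′
  where
  symmetric′ : ∀ i j → join1 F i j ≡ join1 F j i
  symmetric′ zero    zero    = refl
  symmetric′ zero    (suc j) = refl
  symmetric′ (suc i) zero    = refl
  symmetric′ (suc i) (suc j) = symmetric i j
  loopless′ : ∀ i → join1 F i i ≡ false
  loopless′ zero    = refl
  loopless′ (suc i) = loopless i

suc-<?-suc : ∀ a b → ⌊ suc a <? suc b ⌋ ≡ ⌊ a <? b ⌋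
suc-<?-suc a b with a <? b
... | yes a<b rewrite proj₂ (dec-yes (suc a <? suc b) (s≤s a<b)) = refl
... | no  a≮b rewrite dec-no (suc a <? suc b) (a≮b ∘ s<s⁻¹) = refl

edges-join1 : (F : Graph m) → edges (join1 F) ≡ m + edges F
edges-join1 {m} F = begin
  edges (join1 F)
    ≡⟨ edges-∑ (join1 F) ⟩
  -- definitionally: the apex row is 1 off the diagonal, the apex column is never upper

  ∑[ j < m ] 1 + ∑[ i < m ] ∑[ j < m ] upper (join1 F) (suc i) (suc j)
    ≡⟨ cong₂ _+_ (∑-const-1 m) (sum-cong-≗ (λ i → sum-cong-≗ (λ j →
         cong (λ b → if b ∧ F i j then 1 else 0) (suc-<?-suc (toℕ i) (toℕ j))))) ⟩
  m + ∑[ i < m ] ∑[ j < m ] upper F i j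
    ≡⟨ cong (m +_) (edges-∑ F) ⟨
  m + edges F ∎
  where open ≡-Reasoning

edges-≅-join1 : {G : Graph (suc m)} {F : Graph m} → IsSimple G → IsSimple F →
                G ≅ join1 F → edges G ≡ m + edges F
edges-≅-join1 {F = F} simpleG simpleF G≅ =
  trans (edges-≅ simpleG (join1-simple simpleF) G≅) (edges-join1 F)

Dominating : Graph n → Fin n → Set
Dominating G v = ∀ w → w ≢ v → G v w ≡ true

dominating-sym : {G : Graph n} {v : Fin n} → IsSimple G → Dominating G v →
                 ∀ w → w ≢ v → G w v ≡ true
dominating-sym {v = v} (symmetric , _) dom w w≢v = trans (symmetric w v) (dom w w≢v)

-- A vertex missing both itself and w leaves at most n − 2 neighbours.
degree⇒dominating : {G : Graph (suc m)} {v : Fin (suc m)} → IsSimple G →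
                    m ≤ degree G v → Dominating G v
degree⇒dominating {m} {G} {v} (_ , loopless) m≤deg w w≢v with G v w in vw
... | true  = refl
... | false = contradiction (begin-strict
  m                                ≤⟨ m≤deg ⟩
  degree G v                       ≡⟨ degree-∑ G v ⟩
  ∑[ j < suc m ] indicator (G v j) ≡⟨ sum-remove {i = v} (indicator ∘ G v) ⟩
  indicator (G v v) + others       ≡⟨ cong (λ b → indicator b + others) (loopless v) ⟩
  others                           <⟨ ∑-≤1-with-zero⇒< (indicator ∘ G v ∘ punchIn v)
                                        (indicator≤1 ∘ G v ∘ punchIn v) (punchOut (w≢v ∘ sym)) missing ⟩
  m                                ∎) (<-irrefl refl)
  where
  open ≤-Reasoning
  others : ℕ
  others = ∑[ j < m ] indicator (G v (punchIn v j))
  missing : indicator (G v (punchIn v (punchOut (w≢v ∘ sym)))) ≡ 0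
  missing rewrite punchIn-punchOut (w≢v ∘ sym) | vw = refl

removeVertex : Graph (suc m) → Fin (suc m) → Graph m
removeVertex G v i j = G (punchIn v i) (punchIn v j)

removeVertex-simple : {G : Graph (suc m)} {v : Fin (suc m)} → IsSimple G → IsSimple (removeVertex G v)
removeVertex-simple {v = v} (symmetric , loopless) =
  (λ i j → symmetric (punchIn v i) (punchIn v j)) , loopless ∘ punchIn v

data PunchInView (v : Fin (suc m)) : Fin (suc m) → Set where
  at      : PunchInView v v
  punched : ∀ k → PunchInView v (punchIn v k)

punchInView : (v i : Fin (suc m)) → PunchInView v i
punchInView v i with v ≟ i
... | yes refl = at
... | no  v≢i  = subst (PunchInView v) (punchIn-punchOut v≢i) (punched (punchOut v≢i))

moveToFront : Fin (suc m) → Permutation′ (suc m)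
moveToFront v = insert v zero id

moveToFront-at : (v : Fin (suc m)) → moveToFront v ⟨$⟩ʳ v ≡ zero
moveToFront-at v rewrite proj₂ (dec-yes (v ≟ v) refl) = refl

moveToFront-punchIn : (v : Fin (suc m)) (k : Fin m) → moveToFront v ⟨$⟩ʳ punchIn v k ≡ suc k
moveToFront-punchIn v k = insert-punchIn v zero id k

≅-join1-removeVertex : {G : Graph (suc m)} {v : Fin (suc m)} → IsSimple G → Dominating G v →
                       G ≅ join1 (removeVertex G v)
≅-join1-removeVertex {G = G} {v} simple@(_ , loopless) dom = moveToFront v , adjacency
  where
  adjacency : ∀ i j → G i j ≡ join1 (removeVertex G v) (moveToFront v ⟨$⟩ʳ i) (moveToFront v ⟨$⟩ʳ j)
  adjacency i j with punchInView v i | punchInView v j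
  ... | at | at
    rewrite moveToFront-at v = loopless v
  ... | at | punched l
    rewrite moveToFront-at v | moveToFront-punchIn v l = dom (punchIn v l) (punchInᵢ≢i v l)
  ... | punched k | at
    rewrite moveToFront-at v | moveToFront-punchIn v k = dominating-sym simple dom (punchIn v k) (punchInᵢ≢i v k)
  ... | punched k | punched l
    rewrite moveToFront-punchIn v k | moveToFront-punchIn v l = refl

IsEmbedding : Graph h → Graph n → (Fin h → Fin n) → Set
IsEmbedding H G f = Injective _≡_ _≡_ f × (∀ i j → H i j ≡ true → G (f i) (f j) ≡ true)

Contains-mono : {H : Graph h} {G G′ : Graph n} → (∀ i j → G i j ≡ true → G′ i j ≡ true) →
                Contains H G → Contains H G′
Contains-mono G⊆G′ (f , injective , preserves) =
  f , injective , λ i j Hij → G⊆G′ (f i) (f j) (preserves i j Hij)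

Contains-join1 : {H : Graph h} {G : Graph (suc m)} {v : Fin (suc m)} → IsSimple G → Dominating G v →
                 Contains H (removeVertex G v) → Contains (join1 H) G
Contains-join1 {h} {m} {H} {G} {v} simple dom (f , injective , preserves) = g , g-injective , g-preserves
  where
  g : Fin (suc h) → Fin (suc m)
  g zero    = v
  g (suc i) = punchIn v (f i)
  g-injective : Injective _≡_ _≡_ g
  g-injective {zero}  {zero}  _  = refl
  g-injective {zero}  {suc j} eq = contradiction (sym eq) (punchInᵢ≢i v (f j))
  g-injective {suc i} {zero}  eq = contradiction eq (punchInᵢ≢i v (f i))
  g-injective {suc i} {suc j} eq = cong suc (injective (punchIn-injective v _ _ eq))
  g-preserves : ∀ i j → join1 H i j ≡ true → G (g i) (g j) ≡ true
  g-preserves zero    (suc j) _   = dom (g (suc j)) (punchInᵢ≢i v (f j))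
  g-preserves (suc i) zero    _   = dominating-sym simple dom (g (suc i)) (punchInᵢ≢i v (f i))
  g-preserves (suc i) (suc j) Hij = preserves i j Hij

Contains-removeVertex : {H : Graph h} {G : Graph (suc m)} (v : Fin (suc m)) (f : Fin h → Fin (suc m)) →
                        IsEmbedding H G f → (∀ i → f i ≢ v) → Contains H (removeVertex G v)
Contains-removeVertex {h} {m} {H} {G} v f (injective , preserves) f≢v = f′ , f′-injective , f′-preserves
  where
  f′ : Fin h → Fin m
  f′ i = punchOut (f≢v i ∘ sym)
  f′-injective : Injective _≡_ _≡_ f′
  f′-injective {i} {j} = injective ∘ punchOut-injective (f≢v i ∘ sym) (f≢v j ∘ sym)
  f′-preserves : ∀ i j → H i j ≡ true → removeVertex G v (f′ i) (f′ j) ≡ true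
  f′-preserves i j Hij
    rewrite punchIn-punchOut (f≢v i ∘ sym) | punchIn-punchOut (f≢v j ∘ sym) = preserves i j Hij

-- If a vertex of H lies on v, the apex of K₁ ∨ H can take its place.
join1-copy-avoiding : {H : Graph h} {G : Graph n} → (∀ i → H i i ≡ false) →
                      Contains (join1 H) G → (v : Fin n) →
                      Σ (Fin h → Fin n) λ f → IsEmbedding H G f × (∀ i → f i ≢ v)
join1-copy-avoiding {h} {n} {H} {G} loopless (g , injective , preserves) v =
  f , (f-injective , f-preserves) , f≢v
  where
  f : Fin h → Fin n
  f i with g (suc i) ≟ v
  ... | yes _ = g zero
  ... | no  _ = g (suc i)
  f≢v : ∀ i → f i ≢ v
  f≢v i with g (suc i) ≟ v
  ... | yes gi≡v = λ g0≡v → 0≢1+n (injective (trans g0≡v (sym gi≡v)))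
  ... | no  gi≢v = gi≢v
  f-injective : Injective _≡_ _≡_ f
  f-injective {i} {j} eq with g (suc i) ≟ v | g (suc j) ≟ v
  ... | yes gi≡v | yes gj≡v = Fin-suc-injective (injective (trans gi≡v (sym gj≡v)))
  ... | yes _    | no  _    = contradiction (injective eq) 0≢1+n
  ... | no  _    | yes _    = contradiction (injective (sym eq)) 0≢1+n
  ... | no  _    | no  _    = Fin-suc-injective (injective eq)
  f-preserves : ∀ i j → H i j ≡ true → G (f i) (f j) ≡ true
  f-preserves i j Hij with g (suc i) ≟ v | g (suc j) ≟ v
  ... | yes gi≡v | yes gj≡v with Fin-suc-injective (injective (trans gi≡v (sym gj≡v)))
  ...   | refl = contradiction (trans (sym Hij) (loopless i)) λ ()
  f-preserves i j Hij | yes _ | no _ = preserves zero (suc j) refl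
  f-preserves i j Hij | no _ | yes _ = preserves (suc i) zero refl
  f-preserves i j Hij | no _ | no _  = preserves (suc i) (suc j) Hij

punchIn-≟ : (v : Fin (suc m)) (a c : Fin m) → ⌊ punchIn v a ≟ punchIn v c ⌋ ≡ ⌊ a ≟ c ⌋
punchIn-≟ v a c with a ≟ c
... | yes refl rewrite proj₂ (dec-yes (punchIn v a ≟ punchIn v a) refl) = refl
... | no  a≢c  rewrite dec-no (punchIn v a ≟ punchIn v c) (a≢c ∘ punchIn-injective v a c) = refl

removeVertex-addEdge : (G : Graph (suc m)) (v : Fin (suc m)) (u w a c : Fin m) →
  removeVertex (addEdge G (punchIn v u) (punchIn v w)) v a c ≡ addEdge (removeVertex G v) u w a c
removeVertex-addEdge G v u w a c
  rewrite punchIn-≟ v a u | punchIn-≟ v c w | punchIn-≟ v a w | punchIn-≟ v c u = refl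

saturated-removeVertex : {H : Graph h} {G : Graph (suc m)} {v : Fin (suc m)} → IsSimple H →
                         Saturated (join1 H) G → Dominating G v → Saturated H (removeVertex G v)
saturated-removeVertex {m = m} {H} {G} {v} (_ , looplessH) (simple , copy-free , saturating) dom =
  removeVertex-simple simple , copy-free ∘ Contains-join1 simple dom , saturating′
  where
  G⁺ : Fin m → Fin m → Graph (suc m)
  G⁺ u w = addEdge G (punchIn v u) (punchIn v w)
  saturating′ : ∀ u w → u ≢ w → removeVertex G v u w ≡ false → Contains H (addEdge (removeVertex G v) u w)
  saturating′ u w u≢w uw∉F
    with join1-copy-avoiding {G = G⁺ u w} looplessH
           (saturating (punchIn v u) (punchIn v w) (u≢w ∘ punchIn-injective v u w) uw∉F) v
  ... | f , embedding , f≢v =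
    Contains-mono (λ a c → subst (_≡ true) (removeVertex-addEdge G v u w a c))
      (Contains-removeVertex {G = G⁺ u w} v f embedding f≢v)

proposition3p1 : ∀ {h m : ℕ} (H : Graph h) (G : Graph (suc m)) →
    IsSimple H → Saturated (join1 H) G → maxDegree G ≡ m →
    (s : ℕ) → IsSatNumber m H s →
    (m + s ≤ edges G) ×
    (edges G ≡ m + s ⇔
      Σ (Graph m) λ F → Saturated H F × edges F ≡ s × G ≅ join1 F)
proposition3p1 {m = m} H G simpleH saturated Δ≡m s (_ , sat≤) =
  lower-bound , mk⇔ extremal-structure extremal-count
  where
  simpleG : IsSimple G
  simpleG = proj₁ saturated
  v : Fin (suc m)
  v = proj₁ (maxDegree-attained G)
  dom : Dominating G v
  dom = degree⇒dominating simpleG (subst (_≤ degree G v) Δ≡m (proj₂ (maxDegree-attained G)))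
  F : Graph m
  F = removeVertex G v
  saturatedF : Saturated H F
  saturatedF = saturated-removeVertex simpleH saturated dom
  G≅ : G ≅ join1 F
  G≅ = ≅-join1-removeVertex simpleG dom
  edgesG : edges G ≡ m + edges F
  edgesG = edges-≅-join1 simpleG (proj₁ saturatedF) G≅
  lower-bound : m + s ≤ edges G
  lower-bound = ≤-trans (+-monoʳ-≤ m (sat≤ F saturatedF)) (≤-reflexive (sym edgesG))
  extremal-structure : edges G ≡ m + s → Σ (Graph m) λ F → Saturated H F × edges F ≡ s × G ≅ join1 F
  extremal-structure edgesG≡ = F , saturatedF , +-cancelˡ-≡ m (edges F) s (trans (sym edgesG) edgesG≡) , G≅
  extremal-count : (Σ (Graph m) λ F → Saturated H F × edges F ≡ s × G ≅ join1 F) → edges G ≡ m + s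
  extremal-count (F′ , saturatedF′ , edgesF′ , G≅′) =
    trans (edges-≅-join1 simpleG (proj₁ saturatedF′) G≅′) (cong (m +_) edgesF′)
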